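{- At any time during any sequence of operations on two-parent hollow heaps (as defined in the context), every node of rank $r$ has at least $F_{r+3}-1$ virtual descendants (full and hollow), where $F_0=0$, $F_1=1$, $F_i=F_{i-1}+F_{i-2}$ for $i\ge 2$.
   Context: Heaps. A heap stores a finite set of items, each with a key from a totally ordered universe, and supports: make-heap() (return an empty heap); find-min($h$) (return an item of minimum key in $h$, or null if $h$ is empty); insert($e,k,h$) (add item $e$, which is in no heap, with key $k$); delete-min($h$) (delete from non-empty $h$ the item that find-min($h$) returns); meld($h_1,h_2$) (return a heap containing all items of the item-disjoint heaps $h_1,h_2$); decrease-key($e,k,h$) (given an item $e$ in $h$ with key greater than $k$, change its key to $k$); delete($e,h$) (delete item $e$ from $h$). Heaps passed as arguments are destroyed; decrease-key and delete are given the location of $e$. Nodes. Nodes hold items: each node holds at most one item, and is full if it holds one and hollow otherwise; each item in a heap is held by exactly one node; a newly created node is full and a hollow node never becomes full again. Each node $u$ has a key $u.key$ (the current key of its item if $u$ is full; if $u$ is hollow, the key its item had just before leaving $u$) and a non-negative integer rank $u.rank$. A tree (or dag) of nodes with arcs from parent to child is heap-ordered if $v.key\le w.key$ for every arc $(v,w)$; a root is a node with no parent. For two full roots, link makes the one of larger key (ties broken arbitrarily) a child of the other; the new child is the loser and the other the winner. A ranked link is a link of two roots of equal rank and increases the winner's rank by one; an unranked link may be applied to any two full roots and changes no ranks. Two-parent hollow heap. It is either empty or a heap-ordered directed acyclic graph of nodes with one root, which is full; the root is the minimum node. make-heap returns an empty heap; find-min returns the item in the root; meld returns one heap if the other is empty,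 and otherwise does an unranked link of the two roots; insert($e,k,h$) creates a new full node of rank 0 holding $e$ with key $k$ and melds this one-node heap with $h$. decrease-key($e,k,h$), with $u$ the node holding $e$: if $u$ is the root one may simply set $u.key=k$; otherwise create a new node $v$, move $e$ from $u$ to $v$ (so $u$ becomes hollow), set $v.key=k$ and $v.rank=\max\{0,u.rank-2\}$, add the arc $(v,u)$ so that $u$ acquires $v$ as an additional parent (no children of $u$ are moved), and meld the one-node heap $v$ with the heap. delete($e,h$) removes $e$ from the node $u$ holding it, making $u$ hollow; if $u$ is not the root this completes the operation; otherwise, while some root is hollow, destroy such a root (removing its outgoing arcs, so that children left with no parent become roots); then do ranked links while two roots have equal rank; then do unranked links until one root remains. delete-min($h$) performs delete on the item in the root. Virtual parents (an analysis device, not part of the algorithm), defined along the execution: a newly created node has no virtual parent; when a root with no virtual parent loses a ranked link, the winner becomes its virtual parent; when the virtual parent of a node is destroyed, the node has no virtual parent; when a decrease-key moves an item from a node $u$ to a new node $v$, $v$ becomes the virtual parent of every node whose virtual parent is $u$ and whose rank is less than $v.rank=\max\{0,u.rank-2\}$. Otherwise virtual parents do not change. A node $w$ is a virtual child of $v$ if $v$ is the virtual parent of $w$; $w$ is a virtual descendant of $v$ if $w=v$ or $w$ is a virtual descendant of a virtual child of $v$. -}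

module Defs where

open import Level using (Level; _⊔_; 0ℓ) renaming (suc to lsuc)
open import Data.Nat using (ℕ; zero; suc; _+_; _∸_; _≡ᵇ_; _<ᵇ_)
open import Data.Bool using (Bool; true; false; if_then_else_; _∧_; _∨_)
open import Data.Maybe using (Maybe; just; nothing)
open import Data.Product using (Σ; _×_; _,_)
open import Data.Sum using (_⊎_)
open import Relation.Binary.PropositionalEquality using (_≡_; _≢_)
open import Relation.Binary.Bundles using (StrictTotalOrder)
open import Relation.Nullary using (¬_)

fib : ℕ → ℕ
fib zero = 0
fib (suc zero) = 1
fib (suc (suc n)) = fib (suc n) + fib n

-- Two-parent hollow heaps over a totally ordered key universe O.
-- All heaps live in one global store of nodes named by natural numbers.
module HollowHeap {a ℓ₁ ℓ₂ : Level} (O : StrictTotalOrder a ℓ₁ ℓ₂) where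

  open StrictTotalOrder O renaming (Carrier to Key; _<_ to _<ₖ_)

  -- idle: between operations (every heap has exactly one root, which is full);
  -- repairing other: inside a delete of the root of some heap; 'other' holds
  -- exactly the roots of all the other heaps (which are untouched meanwhile).
  data Mode : Set₁ where
    idle      : Mode
    repairing : (other : ℕ → Set) → Mode

  record State : Set (a ⊔ lsuc 0ℓ) where
    field
      next  : ℕ              -- first never-used node name
      alive : ℕ → Bool
      full  : ℕ → Bool
      key   : ℕ → Key
      rank  : ℕ → ℕ
      arc   : ℕ → ℕ → Bool   -- arc x y : x is a parent of y
      vpar  : ℕ → Maybe ℕ    -- virtual parent (analysis device)
      mode  : Mode
  open State public

  upd : ∀ {b} {A : Set b} → (ℕ → A) → ℕ → A → ℕ → A
  upd f i x j = if j ≡ᵇ i then x else f j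

  vpIs : Maybe ℕ → ℕ → Bool
  vpIs (just p) x = p ≡ᵇ x
  vpIs nothing  x = false

  adopt : Maybe ℕ → ℕ → Maybe ℕ
  adopt nothing  w = just w
  adopt (just p) w = just p

  IsRoot : State → ℕ → Set
  IsRoot S w = (alive S w ≡ true) × (∀ x → arc S x w ≡ false)

  data Reach (S : State) : ℕ → ℕ → Set where
    here  : ∀ {x} → Reach S x x
    there : ∀ {x z y} → arc S x z ≡ true → Reach S z y → Reach S x y

  create : State → Key → ℕ → State
  create S k r = record S
    { next  = suc (next S)
    ; alive = upd (alive S) (next S) true
    ; full  = upd (full S) (next S) true
    ; key   = upd (key S) (next S) k
    ; rank  = upd (rank S) (next S) r
    ; arc   = λ x y → if (x ≡ᵇ next S) ∨ (y ≡ᵇ next S) then false else arc S x y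
    ; vpar  = upd (vpar S) (next S) nothing
    }

  linkU : State → ℕ → ℕ → State
  linkU S w l = record S
    { arc = λ x y → if (x ≡ᵇ w) ∧ (y ≡ᵇ l) then true else arc S x y }

  linkR : State → ℕ → ℕ → State
  linkR S w l = record (linkU S w l)
    { rank = upd (rank S) w (suc (rank S w))
    ; vpar = upd (vpar S) l (adopt (vpar S l) w)
    }

  LinkOK : State → ℕ → ℕ → Set ℓ₂
  LinkOK S w l = (w ≢ l) × IsRoot S w × IsRoot S l
               × (full S w ≡ true) × (full S l ≡ true) × ¬ (key S l <ₖ key S w)

  dkNode : State → ℕ → Key → State
  dkNode S u k = record S₁
    { full = upd (full S₁) u false
    ; arc  = λ x y → if (x ≡ᵇ v) ∧ (y ≡ᵇ u) then true else arc S₁ x y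
    ; vpar = λ w → if vpIs (vpar S₁ w) u ∧ (rank S₁ w <ᵇ (rank S u ∸ 2))
                    then just v else vpar S₁ w
    }
    where
    v  = next S
    S₁ = create S k (rank S u ∸ 2)

  -- roots of the heap under repair
  RRoot : State → (ℕ → Set) → ℕ → Set
  RRoot S oth w = IsRoot S w × ¬ oth w

  destroy : State → ℕ → State
  destroy S x = record S
    { alive = upd (alive S) x false
    ; arc   = λ y z → if y ≡ᵇ x then false else arc S y z
    ; vpar  = λ w → if (w ≡ᵇ x) ∨ vpIs (vpar S w) x then nothing else vpar S w
    }

  data Step : State → State → Set (a ⊔ ℓ₂ ⊔ lsuc 0ℓ) where
    -- insert into an empty heap (insert into h = this followed by meld)
    insert : ∀ {S} k → mode S ≡ idle → Step S (create S k 0)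
    meld : ∀ {S w l} → mode S ≡ idle → LinkOK S w l → Step S (linkU S w l)
    decKeyRoot : ∀ {S u k} → mode S ≡ idle → IsRoot S u → full S u ≡ true
               → k <ₖ key S u → Step S (record S { key = upd (key S) u k })
    decKey : ∀ {S u k r w l} → mode S ≡ idle → alive S u ≡ true → full S u ≡ true
           → ¬ IsRoot S u → IsRoot S r → Reach S r u → k <ₖ key S u
           → ((w ≡ next S) × (l ≡ r)) ⊎ ((w ≡ r) × (l ≡ next S))
           → LinkOK (dkNode S u k) w l
           → Step S (linkU (dkNode S u k) w l)
    deleteNonRoot : ∀ {S u} → mode S ≡ idle → alive S u ≡ true → full S u ≡ true
                  → ¬ IsRoot S u → Step S (record S { full = upd (full S) u false })
    deleteRoot : ∀ {S u} → mode S ≡ idle → IsRoot S u → full S u ≡ true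
               → Step S (record S { full = upd (full S) u false
                                  ; mode = repairing (λ w → IsRoot S w × (w ≢ u)) })
    destroyRoot : ∀ {S oth x} → mode S ≡ repairing oth → RRoot S oth x
                → full S x ≡ false → Step S (destroy S x)
    rankedLink : ∀ {S oth w l} → mode S ≡ repairing oth
               → (∀ y → RRoot S oth y → full S y ≡ true)
               → RRoot S oth w → RRoot S oth l → LinkOK S w l → rank S w ≡ rank S l
               → Step S (linkR S w l)
    unrankedLink : ∀ {S oth w l} → mode S ≡ repairing oth
                 → (∀ y → RRoot S oth y → full S y ≡ true)
                 → (∀ y y' → RRoot S oth y → RRoot S oth y' → y ≢ y' → rank S y ≢ rank S y')
                 → RRoot S oth w → RRoot S oth l → LinkOK S w l
                 → Step S (linkU S w l)
    finish : ∀ {S oth} → mode S ≡ repairing oth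
           → (∀ y → RRoot S oth y → full S y ≡ true)
           → (∀ y y' → RRoot S oth y → RRoot S oth y' → y ≡ y')
           → Step S (record S { mode = idle })

  Initial : State → Set₁
  Initial S = (∀ w → alive S w ≡ false) × (∀ x y → arc S x y ≡ false)
            × (∀ w → vpar S w ≡ nothing) × (mode S ≡ idle)

  data Reachable : State → Set (a ⊔ ℓ₂ ⊔ lsuc 0ℓ) where
    start : ∀ {S} → Initial S → Reachable S
    step  : ∀ {S S'} → Reachable S → Step S S' → Reachable S'

  data VDesc (S : State) : ℕ → ℕ → Set where
    self : ∀ {v} → VDesc S v v
    up   : ∀ {w p v} → vpar S w ≡ just p → VDesc S p v → VDesc S w v

-- Every node of a reachable state has a live virtual child of rank i for every i < r if it is full,
-- and for i ∈ {r ∸ 2, r ∸ 1} if it is hollow, where r is its rank; moreover virtual parents have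
-- strictly larger rank and are proper ancestors along arcs.  The ancestor condition is what lets the
-- invariant survive the destruction of a hollow root: a root has no virtual parent, and an arc path
-- from a virtual parent other than the destroyed root cannot pass through it.  Given the invariant,
-- virtual parents form a forest with strictly increasing ranks, so the virtual descendants of the
-- virtual children of ranks r ∸ 1 and r ∸ 2 are disjoint, and the number N r of virtual descendants
-- of a node of rank r satisfies N r ≥ 1 + N (r ∸ 1) + N (r ∸ 2), i.e. N r ≥ F (r + 3) − 1.

module Submission where

open import Defs
open import Level using (Level)
open import Data.Nat using (ℕ; zero; suc; _+_; _∸_; _≤_; _<_; _≡ᵇ_; _<ᵇ_; z≤n; s≤s)
open import Data.Nat.Properties
  using ( _≟_; _<?_; n≮0; <-irrefl; ≤-refl; ≤-reflexive; <⇒≤; <-≤-trans; <⇒≱; ≤⇒≯; n<1+n; n≤1+n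
        ; m<n⇒m<1+n; m<1+n⇒m<n∨m≡n; m∸n≤m; +-suc; +-mono-≤)
open import Data.Bool using (Bool; true; false; _∧_; _∨_)
open import Data.Bool.Properties using (∧-zeroʳ)
open import Data.Maybe using (Maybe; just; nothing)
open import Data.Maybe.Properties using (just-injective)
open import Data.List using (List; []; _∷_; _++_; length)
open import Data.List.Properties using (length-++)
open import Data.List.Relation.Binary.Disjoint.Propositional using (Disjoint)
open import Data.List.Relation.Unary.All as All using (All; []; _∷_)
open import Data.List.Relation.Unary.All.Properties using (++⁺)
open import Data.List.Relation.Unary.AllPairs using ([]; _∷_)
open import Data.List.Relation.Unary.Unique.Propositional using (Unique)
import Data.List.Relation.Unary.Unique.Propositional.Properties as Unique
open import Data.Product as Product using (Σ; _×_; _,_; proj₁; proj₂)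
open import Data.Sum as Sum using (_⊎_; inj₁; inj₂)
open import Data.Empty using (⊥; ⊥-elim)
open import Function using (id)
open import Relation.Nullary using (yes; no)
open import Relation.Nullary.Decidable using (dec-true; dec-false)
open import Relation.Binary.PropositionalEquality
  using (_≡_; _≢_; refl; sym; trans; cong; cong₂; subst; subst₂; module ≡-Reasoning)
open import Relation.Binary.Bundles using (StrictTotalOrder)
open import Relation.Binary.Construct.Closure.Transitive using (TransClosure; [_]; _∷_)

≡ᵇ-≡ : ∀ {m n} → m ≡ n → (m ≡ᵇ n) ≡ true
≡ᵇ-≡ {m} {n} = dec-true (m ≟ n)

≡ᵇ-≢ : ∀ {m n} → m ≢ n → (m ≡ᵇ n) ≡ false
≡ᵇ-≢ {m} {n} = dec-false (m ≟ n)

<ᵇ-< : ∀ {m n} → m < n → (m <ᵇ n) ≡ true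
<ᵇ-< {m} {n} = dec-true (m <? n)

<ᵇ-≥ : ∀ {m n} → n ≤ m → (m <ᵇ n) ≡ false
<ᵇ-≥ {m} {n} n≤m = dec-false (m <? n) (≤⇒≯ n≤m)

true≢false : ∀ {b} → b ≡ true → b ≡ false → ⊥
true≢false refl ()

nothing≢just : ∀ {A : Set} {x : A} → nothing ≢ just x
nothing≢just ()

module _ {A : Set} {R : A → A → Set} where

  ⁺-map : ∀ {Q : A → A → Set} → (∀ {x y} → R x y → Q x y)
        → ∀ {x y} → TransClosure R x y → TransClosure Q x y
  ⁺-map f [ r ]    = [ f r ]
  ⁺-map f (r ∷ rs) = f r ∷ ⁺-map f rs

  ⁺-head : ∀ {x y} → TransClosure R x y → Σ A (R x)
  ⁺-head [ r ]   = _ , r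
  ⁺-head (r ∷ _) = _ , r

  ⁺-last : ∀ {x y} → TransClosure R x y → Σ A (λ z → R z y)
  ⁺-last [ r ]    = _ , r
  ⁺-last (_ ∷ rs) = ⁺-last rs

minVDescendants : ℕ → ℕ
minVDescendants 0             = 1
minVDescendants 1             = 2
minVDescendants (suc (suc r)) = suc (minVDescendants (suc r) + minVDescendants r)

suc-minVDescendants : ∀ r → suc (minVDescendants r) ≡ fib (r + 3)
suc-minVDescendants 0             = refl
suc-minVDescendants 1             = refl
suc-minVDescendants (suc (suc r)) = begin
  suc (suc (minVDescendants (suc r) + minVDescendants r))  ≡⟨ cong suc (sym (+-suc _ _)) ⟩
  suc (minVDescendants (suc r)) + suc (minVDescendants r)
    ≡⟨ cong₂ _+_ (suc-minVDescendants (suc r)) (suc-minVDescendants r) ⟩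
  fib (suc r + 3) + fib (r + 3)                            ∎
  where open ≡-Reasoning

module _ {a ℓ₁ ℓ₂ : Level} (O : StrictTotalOrder a ℓ₁ ℓ₂) where
  open HollowHeap O
  open StrictTotalOrder O using () renaming (Carrier to Key)

  upd-≡ : ∀ {b} {A : Set b} (f : ℕ → A) i x → upd f i x i ≡ x
  upd-≡ f i x rewrite ≡ᵇ-≡ {i} refl = refl

  upd-≢ : ∀ {b} {A : Set b} (f : ℕ → A) {i} x {j} → j ≢ i → upd f i x j ≡ f j
  upd-≢ f x j≢i rewrite ≡ᵇ-≢ j≢i = refl

  Arc : State → ℕ → ℕ → Set
  Arc S x y = arc S x y ≡ true

  ProperAncestor : State → ℕ → ℕ → Set
  ProperAncestor S = TransClosure (Arc S)

  HasVChildOfRank : State → ℕ → ℕ → Set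
  HasVChildOfRank S u i = Σ ℕ λ c → alive S c ≡ true × vpar S c ≡ just u × rank S c ≡ i

  NeedsVChildOfRank : State → ℕ → ℕ → Set
  NeedsVChildOfRank S u i = i < rank S u × (full S u ≡ true ⊎ rank S u ∸ 2 ≤ i)

  needsVChild-transfer : ∀ S′ S {u i} → rank S′ u ≡ rank S u → (full S′ u ≡ true → full S u ≡ true)
                       → NeedsVChildOfRank S′ u i → NeedsVChildOfRank S u i
  needsVChild-transfer _ _ {i = i} r′≡r f⊆ (i< , due) =
    subst (i <_) r′≡r i< , Sum.map f⊆ (subst (λ r → r ∸ 2 ≤ i) r′≡r) due

  record Invariant (S : State) : Set where
    field
      alive⇒<next   : ∀ {w} → alive S w ≡ true → w < next S
      arc⇒alive     : ∀ {x y} → Arc S x y → alive S x ≡ true × alive S y ≡ true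
      vpar⇒ancestor : ∀ {w p} → vpar S w ≡ just p → ProperAncestor S p w
      vpar⇒rank<    : ∀ {w p} → vpar S w ≡ just p → rank S w < rank S p
      vchild        : ∀ {u i} → alive S u ≡ true → NeedsVChildOfRank S u i → HasVChildOfRank S u i

  module InvariantFacts {S : State} (I : Invariant S) where
    open Invariant I

    alive⇒≢next : ∀ {w} → alive S w ≡ true → w ≢ next S
    alive⇒≢next aw refl = <-irrefl refl (alive⇒<next aw)

    vpar⇒alive : ∀ {w p} → vpar S w ≡ just p → alive S p ≡ true × alive S w ≡ true
    vpar⇒alive vw = proj₁ (arc⇒alive (proj₂ (⁺-head (vpar⇒ancestor vw))))
                  , proj₂ (arc⇒alive (proj₂ (⁺-last (vpar⇒ancestor vw))))

    vpar⇒≢next : ∀ {w p} → vpar S w ≡ just p → w ≢ next S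
    vpar⇒≢next vw = alive⇒≢next (proj₂ (vpar⇒alive vw))

    vpar⇒≢root : ∀ {w p x} → vpar S w ≡ just p → IsRoot S x → w ≢ x
    vpar⇒≢root vw (_ , parentless) refl with ⁺-last (vpar⇒ancestor vw)
    ... | z , zw = true≢false zw (parentless z)

    root⇒no-vpar : ∀ {x} → IsRoot S x → vpar S x ≡ nothing
    root⇒no-vpar {x} rx with vpar S x in vx
    ... | nothing = refl
    ... | just _  = ⊥-elim (vpar⇒≢root vx rx refl)

  invariant-initial : ∀ {S} → Initial S → Invariant S
  invariant-initial (dead , arcless , orphan , _) = record
    { alive⇒<next   = λ {w} aw → ⊥-elim (true≢false aw (dead w))
    ; arc⇒alive     = λ {x} {y} xy → ⊥-elim (true≢false xy (arcless x y))
    ; vpar⇒ancestor = λ {w} vw → ⊥-elim (nothing≢just (trans (sym (orphan w)) vw))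
    ; vpar⇒rank<    = λ {w} vw → ⊥-elim (nothing≢just (trans (sym (orphan w)) vw))
    ; vchild        = λ {u} au → ⊥-elim (true≢false au (dead u))
    }

  invariant-reshape : ∀ {S} → Invariant S → ∀ {k′ f a m}
    → (∀ {x y} → Arc S x y → a x y ≡ true)
    → (∀ {x y} → a x y ≡ true → alive S x ≡ true × alive S y ≡ true)
    → (∀ {u} → f u ≡ true → full S u ≡ true)
    → Invariant (record S { key = k′ ; full = f ; arc = a ; mode = m })
  invariant-reshape {S} I {k′} {f} {a} {m} arc⊆ a⇒alive f⊆ = record
    { alive⇒<next   = alive⇒<next
    ; arc⇒alive     = a⇒alive
    ; vpar⇒ancestor = λ vw → ⁺-map arc⊆ (vpar⇒ancestor vw)
    ; vpar⇒rank<    = vpar⇒rank<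
    ; vchild        = λ au needs → vchild au (needsVChild-transfer S′ S refl f⊆ needs)
    }
    where
    open Invariant I
    S′ : State
    S′ = record S { key = k′ ; full = f ; arc = a ; mode = m }

  linkU-arc⁺ : ∀ S w l {x y} → Arc S x y → Arc (linkU S w l) x y
  linkU-arc⁺ S w l {x} {y} xy with (x ≡ᵇ w) ∧ (y ≡ᵇ l)
  ... | true  = refl
  ... | false = xy

  linkU-arc-new : ∀ S w l → Arc (linkU S w l) w l
  linkU-arc-new S w l rewrite ≡ᵇ-≡ {w} refl | ≡ᵇ-≡ {l} refl = refl

  linkU-arc⁻ : ∀ S w l {x y} → Arc (linkU S w l) x y → (x ≡ w × y ≡ l) ⊎ Arc S x y
  linkU-arc⁻ S w l {x} {y} xy with x ≟ w | y ≟ l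
  ... | yes refl | yes refl = inj₁ (refl , refl)
  ... | yes refl | no y≢l rewrite ≡ᵇ-≢ y≢l | ∧-zeroʳ (x ≡ᵇ x) = inj₂ xy
  ... | no x≢w   | _      rewrite ≡ᵇ-≢ x≢w = inj₂ xy

  invariant-linkU : ∀ {S w l} → Invariant S → alive S w ≡ true → alive S l ≡ true → Invariant (linkU S w l)
  invariant-linkU {S} {w} {l} I aw al = invariant-reshape I (linkU-arc⁺ S w l) endpoints-alive id
    where
    endpoints-alive : ∀ {x y} → Arc (linkU S w l) x y → alive S x ≡ true × alive S y ≡ true
    endpoints-alive xy with linkU-arc⁻ S w l xy
    ... | inj₁ (refl , refl) = aw , al
    ... | inj₂ old           = Invariant.arc⇒alive I old

  module Create {S : State} (I : Invariant S) (k : Key) (r : ℕ) where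
    open Invariant I
    open InvariantFacts I

    S′ : State
    S′ = create S k r

    alive⁺ : ∀ {z} → alive S z ≡ true → alive S′ z ≡ true
    alive⁺ az = trans (upd-≢ (alive S) true (alive⇒≢next az)) az

    alive⁻ : ∀ {z} → alive S′ z ≡ true → z ≢ next S → alive S z ≡ true
    alive⁻ az z≢n = trans (sym (upd-≢ (alive S) true z≢n)) az

    alive-new : alive S′ (next S) ≡ true
    alive-new = upd-≡ (alive S) (next S) true

    full-old : ∀ {z} → alive S z ≡ true → full S′ z ≡ full S z
    full-old az = upd-≢ (full S) true (alive⇒≢next az)

    rank-old : ∀ {z} → alive S z ≡ true → rank S′ z ≡ rank S z
    rank-old az = upd-≢ (rank S) r (alive⇒≢next az)

    rank-new : rank S′ (next S) ≡ r
    rank-new = upd-≡ (rank S) (next S) r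

    vpar-old : ∀ {z} → alive S z ≡ true → vpar S′ z ≡ vpar S z
    vpar-old az = upd-≢ (vpar S) nothing (alive⇒≢next az)

    vpar⁻ : ∀ {z p} → vpar S′ z ≡ just p → vpar S z ≡ just p
    vpar⁻ {z} vz with z ≟ next S
    ... | yes refl rewrite ≡ᵇ-≡ {next S} refl = ⊥-elim (nothing≢just vz)
    ... | no z≢n   rewrite ≡ᵇ-≢ z≢n = vz

    arc⁺ : ∀ {x y} → Arc S x y → Arc S′ x y
    arc⁺ xy rewrite ≡ᵇ-≢ (alive⇒≢next (proj₁ (arc⇒alive xy)))
                  | ≡ᵇ-≢ (alive⇒≢next (proj₂ (arc⇒alive xy))) = xy

    arc⁻ : ∀ {x y} → Arc S′ x y → Arc S x y
    arc⁻ {x} {y} xy with (x ≡ᵇ next S) ∨ (y ≡ᵇ next S)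
    ... | true  = ⊥-elim (true≢false xy refl)
    ... | false = xy

    alive⇒<next′ : ∀ {w} → alive S′ w ≡ true → w < next S′
    alive⇒<next′ {w} aw with w ≟ next S
    ... | yes refl = n<1+n (next S)
    ... | no w≢n   = m<n⇒m<1+n (alive⇒<next (alive⁻ aw w≢n))

    arc⇒alive′ : ∀ {x y} → Arc S′ x y → alive S′ x ≡ true × alive S′ y ≡ true
    arc⇒alive′ xy = Product.map alive⁺ alive⁺ (arc⇒alive (arc⁻ xy))

    rank<⁺ : ∀ {w p} → vpar S w ≡ just p → rank S′ w < rank S′ p
    rank<⁺ vw = subst₂ _<_ (sym (rank-old (proj₂ (vpar⇒alive vw)))) (sym (rank-old (proj₁ (vpar⇒alive vw))))
                          (vpar⇒rank< vw)

    vchild⁺ : ∀ {u i} → HasVChildOfRank S u i → HasVChildOfRank S′ u i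
    vchild⁺ (c , ac , vc , rc) = c , alive⁺ ac , trans (vpar-old ac) vc , trans (rank-old ac) rc

    needsVChild⁻ : ∀ {u i} → alive S u ≡ true → NeedsVChildOfRank S′ u i → NeedsVChildOfRank S u i
    needsVChild⁻ au = needsVChild-transfer S′ S (rank-old au) (trans (sym (full-old au)))

  invariant-insert : ∀ {S} → Invariant S → ∀ k → Invariant (create S k 0)
  invariant-insert {S} I k = record
    { alive⇒<next   = alive⇒<next′
    ; arc⇒alive     = arc⇒alive′
    ; vpar⇒ancestor = λ vw → ⁺-map arc⁺ (vpar⇒ancestor (vpar⁻ vw))
    ; vpar⇒rank<    = λ vw → rank<⁺ (vpar⁻ vw)
    ; vchild        = vchild′
    }
    where
    open Invariant I
    open Create I k 0

    vchild′ : ∀ {u i} → alive S′ u ≡ true → NeedsVChildOfRank S′ u i → HasVChildOfRank S′ u i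
    vchild′ {u} au needs with u ≟ next S
    ... | yes refl = ⊥-elim (n≮0 (subst (_ <_) rank-new (proj₁ needs)))
    ... | no u≢n   = vchild⁺ (vchild (alive⁻ au u≢n) (needsVChild⁻ (alive⁻ au u≢n) needs))

  module DecreaseKey {S : State} (I : Invariant S) {u : ℕ} (k : Key)
                     (au : alive S u ≡ true) (fu : full S u ≡ true) where
    open Invariant I
    open InvariantFacts I
    open Create I k (rank S u ∸ 2) renaming (S′ to S₁)

    D : State
    D = dkNode S u k

    moved : ∀ {c} → vpar S c ≡ just u → rank S c < rank S u ∸ 2 → vpar D c ≡ just (next S)
    moved vc lt rewrite ≡ᵇ-≢ (vpar⇒≢next vc) | vc | ≡ᵇ-≡ {u} refl | <ᵇ-< lt = refl

    kept : ∀ {c p} → vpar S c ≡ just p → p ≢ u ⊎ rank S u ∸ 2 ≤ rank S c → vpar D c ≡ just p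
    kept vc (inj₁ p≢u) rewrite ≡ᵇ-≢ (vpar⇒≢next vc) | vc | ≡ᵇ-≢ p≢u = refl
    kept {p = p} vc (inj₂ r₂≤) rewrite ≡ᵇ-≢ (vpar⇒≢next vc) | vc | <ᵇ-≥ r₂≤
                                     | ∧-zeroʳ (p ≡ᵇ u) = refl

    vpar-moved-or-kept : ∀ {z p} → vpar D z ≡ just p
                       → (p ≡ next S × vpar S z ≡ just u × rank S z < rank S u ∸ 2) ⊎ vpar S z ≡ just p
    vpar-moved-or-kept {z} vz with z ≟ next S
    ... | yes refl rewrite ≡ᵇ-≡ {next S} refl = ⊥-elim (nothing≢just vz)
    ... | no z≢n rewrite ≡ᵇ-≢ z≢n with vpar S z
    ...   | nothing = ⊥-elim (nothing≢just vz)
    ...   | just q with q ≟ u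
    ...     | no q≢u rewrite ≡ᵇ-≢ q≢u = inj₂ vz
    ...     | yes refl rewrite ≡ᵇ-≡ {q} refl with rank S z <? rank S u ∸ 2
    ...       | yes lt rewrite <ᵇ-< lt = inj₁ (sym (just-injective vz) , refl , lt)
    ...       | no ¬lt rewrite dec-false (rank S z <? rank S u ∸ 2) ¬lt = inj₂ vz

    arc-old : ∀ {x y} → Arc S x y → Arc D x y
    arc-old xy = linkU-arc⁺ S₁ (next S) u (arc⁺ xy)

    arc⇒aliveD : ∀ {x y} → Arc D x y → alive D x ≡ true × alive D y ≡ true
    arc⇒aliveD {x} {y} xy with linkU-arc⁻ S₁ (next S) u {x} {y} xy
    ... | inj₁ (refl , refl) = alive-new , alive⁺ au
    ... | inj₂ old           = arc⇒alive′ old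

    vpar⇒ancestorD : ∀ {z p} → vpar D z ≡ just p → ProperAncestor D p z
    vpar⇒ancestorD vz with vpar-moved-or-kept vz
    ... | inj₁ (refl , vz₀ , _) = linkU-arc-new S₁ (next S) u ∷ ⁺-map arc-old (vpar⇒ancestor vz₀)
    ... | inj₂ vz₀              = ⁺-map arc-old (vpar⇒ancestor vz₀)

    vpar⇒rank<D : ∀ {z p} → vpar D z ≡ just p → rank D z < rank D p
    vpar⇒rank<D vz with vpar-moved-or-kept vz
    ... | inj₁ (refl , vz₀ , lt) = subst₂ _<_ (sym (rank-old (proj₂ (vpar⇒alive vz₀)))) (sym rank-new) lt
    ... | inj₂ vz₀               = rank<⁺ vz₀

    keep : ∀ {u′ i} → HasVChildOfRank S u′ i → u′ ≢ u ⊎ rank S u ∸ 2 ≤ i → HasVChildOfRank D u′ i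
    keep (c , ac , vc , refl) ok = c , alive⁺ ac , kept vc ok , rank-old ac

    move : ∀ {i} → HasVChildOfRank S u i → i < rank S u ∸ 2 → HasVChildOfRank D (next S) i
    move (c , ac , vc , refl) lt = c , alive⁺ ac , moved vc lt , rank-old ac

    vchildD : ∀ {u′ i} → alive D u′ ≡ true → NeedsVChildOfRank D u′ i → HasVChildOfRank D u′ i
    vchildD {u′} {i} au′ (i< , due) with u′ ≟ next S
    ... | yes refl = move (vchild au (<-≤-trans i<r₂ (m∸n≤m _ 2) , inj₁ fu)) i<r₂
      where
      i<r₂ : i < rank S u ∸ 2
      i<r₂ = subst (i <_) rank-new i<
    ... | no u′≢n with u′ ≟ u
    ...   | yes refl = keep (vchild au (subst (i <_) (rank-old au) i< , inj₂ r₂≤i)) (inj₂ r₂≤i)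
      where
      hollow-due : full D u ≡ true ⊎ rank D u ∸ 2 ≤ i → rank S u ∸ 2 ≤ i
      hollow-due (inj₁ full-u) = ⊥-elim (true≢false full-u (upd-≡ (full S₁) u false))
      hollow-due (inj₂ r₂≤)    = subst (λ r → r ∸ 2 ≤ i) (rank-old au) r₂≤
      r₂≤i : rank S u ∸ 2 ≤ i
      r₂≤i = hollow-due due
    ...   | no u′≢u  =
      keep (vchild au′₀ (needsVChild-transfer D S (rank-old au′₀) full⁻ (i< , due))) (inj₁ u′≢u)
      where
      au′₀ : alive S u′ ≡ true
      au′₀ = alive⁻ au′ u′≢n
      full⁻ : full D u′ ≡ true → full S u′ ≡ true
      full⁻ f = trans (sym (trans (upd-≢ (full S₁) false u′≢u) (full-old au′₀))) f

  invariant-dkNode : ∀ {S u} → Invariant S → ∀ k → alive S u ≡ true → full S u ≡ true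
                   → Invariant (dkNode S u k)
  invariant-dkNode {S} {u} I k au fu = record
    { alive⇒<next   = alive⇒<next′
    ; arc⇒alive     = arc⇒aliveD
    ; vpar⇒ancestor = vpar⇒ancestorD
    ; vpar⇒rank<    = vpar⇒rank<D
    ; vchild        = vchildD
    }
    where
    open DecreaseKey I k au fu
    open Create I k (rank S u ∸ 2)

  module RankedLink {S : State} (I : Invariant S) {w l : ℕ} (w≢l : w ≢ l) (rw : IsRoot S w) (rl : IsRoot S l)
                    (fw : full S w ≡ true) (rank-w≡rank-l : rank S w ≡ rank S l) where
    open Invariant I
    open InvariantFacts I

    S′ : State
    S′ = linkR S w l

    l≢w : l ≢ w
    l≢w l≡w = w≢l (sym l≡w)

    rank-winner : rank S′ w ≡ suc (rank S w)
    rank-winner = upd-≡ (rank S) w _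

    rank-other : ∀ {z} → z ≢ w → rank S′ z ≡ rank S z
    rank-other = upd-≢ (rank S) _

    rank≤ : ∀ z → rank S z ≤ rank S′ z
    rank≤ z with z ≟ w
    ... | yes refl = subst (rank S w ≤_) (sym rank-winner) (n≤1+n _)
    ... | no z≢w   = ≤-reflexive (sym (rank-other z≢w))

    vpar-loser : vpar S′ l ≡ just w
    vpar-loser = trans (upd-≡ (vpar S) l _) (cong (λ m → adopt m w) (root⇒no-vpar rl))

    vpar-other : ∀ {z} → z ≢ l → vpar S′ z ≡ vpar S z
    vpar-other = upd-≢ (vpar S) _

    vchild⁺ : ∀ {u i} → HasVChildOfRank S u i → HasVChildOfRank S′ u i
    vchild⁺ (c , ac , vc , rc) =
      c , ac , trans (vpar-other (vpar⇒≢root vc rl)) vc , trans (rank-other (vpar⇒≢root vc rw)) rc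

    vpar⇒ancestor′ : ∀ {z p} → vpar S′ z ≡ just p → ProperAncestor S′ p z
    vpar⇒ancestor′ {z} vz with z ≟ l
    ... | no z≢l   = ⁺-map (linkU-arc⁺ S w l) (vpar⇒ancestor (trans (sym (vpar-other z≢l)) vz))
    ... | yes refl with just-injective (trans (sym vpar-loser) vz)
    ...   | refl = [ linkU-arc-new S w l ]

    vpar⇒rank<′ : ∀ {z p} → vpar S′ z ≡ just p → rank S′ z < rank S′ p
    vpar⇒rank<′ {z} {p} vz with z ≟ l
    ... | no z≢l =
      subst (_< rank S′ p) (sym (rank-other (vpar⇒≢root vz₀ rw))) (<-≤-trans (vpar⇒rank< vz₀) (rank≤ p))
      where
      vz₀ : vpar S z ≡ just p
      vz₀ = trans (sym (vpar-other z≢l)) vz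
    ... | yes refl with just-injective (trans (sym vpar-loser) vz)
    ...   | refl = subst₂ _<_ (trans rank-w≡rank-l (sym (rank-other l≢w))) (sym rank-winner)
                          (n<1+n (rank S w))

    vchild′ : ∀ {u i} → alive S′ u ≡ true → NeedsVChildOfRank S′ u i → HasVChildOfRank S′ u i
    vchild′ {u} {i} au (i< , due) with u ≟ w
    ... | no u≢w   = vchild⁺ (vchild au (needsVChild-transfer S′ S (rank-other u≢w) id (i< , due)))
    ... | yes refl with m<1+n⇒m<n∨m≡n (subst (i <_) rank-winner i<)
    ...   | inj₁ i<r  = vchild⁺ (vchild (proj₁ rw) (i<r , inj₁ fw))
    ...   | inj₂ refl = l , proj₁ rl , vpar-loser , trans (rank-other l≢w) (sym rank-w≡rank-l)

  invariant-linkR : ∀ {S w l} → Invariant S → w ≢ l → IsRoot S w → IsRoot S l → full S w ≡ true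
                  → rank S w ≡ rank S l → Invariant (linkR S w l)
  invariant-linkR {S} {w} {l} I w≢l rw rl fw rank≡ = record
    { alive⇒<next   = Invariant.alive⇒<next linked
    ; arc⇒alive     = Invariant.arc⇒alive linked
    ; vpar⇒ancestor = vpar⇒ancestor′
    ; vpar⇒rank<    = vpar⇒rank<′
    ; vchild        = vchild′
    }
    where
    open RankedLink I w≢l rw rl fw rank≡
    linked : Invariant (linkU S w l)
    linked = invariant-linkU I (proj₁ rw) (proj₁ rl)

  module Destroy {S : State} (I : Invariant S) {x : ℕ} (rx : IsRoot S x) where
    open Invariant I
    open InvariantFacts I

    S′ : State
    S′ = destroy S x

    arc-target≢x : ∀ {y z} → Arc S y z → z ≢ x
    arc-target≢x yz refl = true≢false yz (proj₂ rx _)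

    alive⁺ : ∀ {z} → z ≢ x → alive S z ≡ true → alive S′ z ≡ true
    alive⁺ z≢x az = trans (upd-≢ (alive S) false z≢x) az

    alive⁻ : ∀ {z} → alive S′ z ≡ true → z ≢ x × alive S z ≡ true
    alive⁻ {z} az with z ≟ x
    ... | yes refl rewrite ≡ᵇ-≡ {x} refl = ⊥-elim (true≢false az refl)
    ... | no z≢x   rewrite ≡ᵇ-≢ z≢x = z≢x , az

    arc⁺ : ∀ {y z} → y ≢ x → Arc S y z → Arc S′ y z
    arc⁺ y≢x yz rewrite ≡ᵇ-≢ y≢x = yz

    arc⁻ : ∀ {y z} → Arc S′ y z → y ≢ x × Arc S y z
    arc⁻ {y} yz with y ≟ x
    ... | yes refl rewrite ≡ᵇ-≡ {x} refl = ⊥-elim (true≢false yz refl)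
    ... | no y≢x   rewrite ≡ᵇ-≢ y≢x = y≢x , yz

    vpar⁺ : ∀ {z p} → z ≢ x → p ≢ x → vpar S z ≡ just p → vpar S′ z ≡ just p
    vpar⁺ z≢x p≢x vz rewrite ≡ᵇ-≢ z≢x | vz | ≡ᵇ-≢ p≢x = refl

    vpar⁻ : ∀ {z p} → vpar S′ z ≡ just p → p ≢ x × vpar S z ≡ just p
    vpar⁻ {z} vz with z ≟ x
    ... | yes refl rewrite ≡ᵇ-≡ {x} refl = ⊥-elim (nothing≢just vz)
    ... | no z≢x rewrite ≡ᵇ-≢ z≢x with vpar S z
    ...   | nothing = ⊥-elim (nothing≢just vz)
    ...   | just q with q ≟ x
    ...     | yes refl rewrite ≡ᵇ-≡ {x} refl = ⊥-elim (nothing≢just vz)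
    ...     | no q≢x rewrite ≡ᵇ-≢ q≢x with just-injective vz
    ...       | refl = q≢x , refl

    ancestor⁺ : ∀ {p z} → p ≢ x → ProperAncestor S p z → ProperAncestor S′ p z
    ancestor⁺ p≢x [ pz ]     = [ arc⁺ p≢x pz ]
    ancestor⁺ p≢x (pq ∷ qz) = arc⁺ p≢x pq ∷ ancestor⁺ (arc-target≢x pq) qz

    arc⇒alive′ : ∀ {y z} → Arc S′ y z → alive S′ y ≡ true × alive S′ z ≡ true
    arc⇒alive′ yz with arc⁻ yz
    ... | y≢x , yz₀ = Product.map (alive⁺ y≢x) (alive⁺ (arc-target≢x yz₀)) (arc⇒alive yz₀)

    vchild′ : ∀ {u i} → alive S′ u ≡ true → NeedsVChildOfRank S′ u i → HasVChildOfRank S′ u i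
    vchild′ au needs with alive⁻ au
    ... | u≢x , au₀ with vchild au₀ needs
    ...   | c , ac , vc , rc = c , alive⁺ (vpar⇒≢root vc rx) ac , vpar⁺ (vpar⇒≢root vc rx) u≢x vc , rc

  invariant-destroy : ∀ {S x} → Invariant S → IsRoot S x → Invariant (destroy S x)
  invariant-destroy I rx = record
    { alive⇒<next   = λ az → Invariant.alive⇒<next I (proj₂ (alive⁻ az))
    ; arc⇒alive     = arc⇒alive′
    ; vpar⇒ancestor = λ vz → ancestor⁺ (proj₁ (vpar⁻ vz)) (Invariant.vpar⇒ancestor I (proj₂ (vpar⁻ vz)))
    ; vpar⇒rank<    = λ vz → Invariant.vpar⇒rank< I (proj₂ (vpar⁻ vz))
    ; vchild        = vchild′
    }
    where open Destroy I rx

  hollowing⇒full : ∀ (f : ℕ → Bool) {u z} → upd f u false z ≡ true → f z ≡ true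
  hollowing⇒full f {u} {z} fz with z ≡ᵇ u
  ... | true  = ⊥-elim (true≢false fz refl)
  ... | false = fz

  invariant-step : ∀ {S S′} → Invariant S → Step S S′ → Invariant S′
  invariant-step I (insert k _) = invariant-insert I k
  invariant-step I (meld _ (_ , rw , rl , _)) = invariant-linkU I (proj₁ rw) (proj₁ rl)
  invariant-step I (decKeyRoot _ _ _ _) = invariant-reshape I id (Invariant.arc⇒alive I) id
  invariant-step I (decKey {k = k} _ au fu _ _ _ _ _ (_ , rw , rl , _)) =
    invariant-linkU (invariant-dkNode I k au fu) (proj₁ rw) (proj₁ rl)
  invariant-step {S} I (deleteNonRoot _ _ _ _) =
    invariant-reshape I id (Invariant.arc⇒alive I) (hollowing⇒full (full S))
  invariant-step {S} I (deleteRoot _ _ _) =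
    invariant-reshape I id (Invariant.arc⇒alive I) (hollowing⇒full (full S))
  invariant-step I (destroyRoot _ (rx , _) _) = invariant-destroy I rx
  invariant-step I (rankedLink _ _ _ _ (w≢l , rw , rl , fw , _) rank≡) = invariant-linkR I w≢l rw rl fw rank≡
  invariant-step I (unrankedLink _ _ _ _ _ (_ , rw , rl , _)) = invariant-linkU I (proj₁ rw) (proj₁ rl)
  invariant-step I (finish _ _ _) = invariant-reshape I id (Invariant.arc⇒alive I) id

  reachable⇒invariant : ∀ {S} → Reachable S → Invariant S
  reachable⇒invariant (start init) = invariant-initial init
  reachable⇒invariant (step R s)   = invariant-step (reachable⇒invariant R) s

  LiveVDescs : State → ℕ → List ℕ → Set
  LiveVDescs S v = All (λ w → alive S w ≡ true × VDesc S w v)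

  VDescList : State → ℕ → ℕ → Set
  VDescList S v n = Σ (List ℕ) λ ws → Unique ws × LiveVDescs S v ws × n ≤ length ws

  module Counting (S : State)
    (vpar⇒rank< : ∀ {w p} → vpar S w ≡ just p → rank S w < rank S p)
    (vchild : ∀ {u i} → alive S u ≡ true → NeedsVChildOfRank S u i → HasVChildOfRank S u i) where

    vdesc⇒rank≤ : ∀ {w v} → VDesc S w v → rank S w ≤ rank S v
    vdesc⇒rank≤ self      = ≤-refl
    vdesc⇒rank≤ (up vw d) = <⇒≤ (<-≤-trans (vpar⇒rank< vw) (vdesc⇒rank≤ d))

    vdesc-snoc : ∀ {w c v} → VDesc S w c → vpar S c ≡ just v → VDesc S w v
    vdesc-snoc self      vc = up vc self
    vdesc-snoc (up vw d) vc = up vw (vdesc-snoc d vc)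

    vdesc-comparable : ∀ {w a b} → VDesc S w a → VDesc S w b → VDesc S a b ⊎ VDesc S b a
    vdesc-comparable self      d           = inj₁ d
    vdesc-comparable (up vw d) self        = inj₂ (up vw d)
    vdesc-comparable (up vw d) (up vw′ d′) with trans (sym vw) vw′
    ... | refl = vdesc-comparable d d′

    vchildren-disjoint : ∀ {v c₁ c₂ w} → vpar S c₁ ≡ just v → vpar S c₂ ≡ just v → rank S c₂ < rank S c₁
                       → VDesc S w c₁ → VDesc S w c₂ → ⊥
    vchildren-disjoint vc₁ vc₂ c₂<c₁ d₁ d₂ with vdesc-comparable d₁ d₂
    ... | inj₁ c₁⇝c₂ = <⇒≱ c₂<c₁ (vdesc⇒rank≤ c₁⇝c₂)
    ... | inj₂ self  = <⇒≱ c₂<c₁ ≤-refl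
    ... | inj₂ (up vc₂′ v⇝c₁) with trans (sym vc₂) vc₂′
    ...   | refl = <⇒≱ (vpar⇒rank< vc₁) (vdesc⇒rank≤ v⇝c₁)

    vdescs-lift : ∀ {c v ws} → vpar S c ≡ just v → LiveVDescs S c ws → LiveVDescs S v ws
    vdescs-lift vc = All.map (Product.map₂ (λ d → vdesc-snoc d vc))

    higher-rank-∉ : ∀ {c v ws} → rank S c < rank S v → LiveVDescs S c ws → All (v ≢_) ws
    higher-rank-∉ c<v = All.map λ { (_ , d) refl → <⇒≱ c<v (vdesc⇒rank≤ d) }

    vdescList-one-child : ∀ {v c n} → alive S v ≡ true → vpar S c ≡ just v
                        → VDescList S c n → VDescList S v (suc n)
    vdescList-one-child {v} av vc (ws , unique , ds , n≤) =
      v ∷ ws , higher-rank-∉ (vpar⇒rank< vc) ds ∷ unique , (av , self) ∷ vdescs-lift vc ds , s≤s n≤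

    vdescList-two-children : ∀ {v c₁ c₂ n₁ n₂} → alive S v ≡ true → vpar S c₁ ≡ just v → vpar S c₂ ≡ just v
                           → rank S c₂ < rank S c₁ → VDescList S c₁ n₁ → VDescList S c₂ n₂
                           → VDescList S v (suc (n₁ + n₂))
    vdescList-two-children {v} av vc₁ vc₂ c₂<c₁ (ws₁ , unique₁ , ds₁ , n₁≤) (ws₂ , unique₂ , ds₂ , n₂≤) =
      v ∷ ws₁ ++ ws₂ ,
      ++⁺ (higher-rank-∉ (vpar⇒rank< vc₁) ds₁) (higher-rank-∉ (vpar⇒rank< vc₂) ds₂)
        ∷ Unique.++⁺ unique₁ unique₂ disjoint ,
      (av , self) ∷ ++⁺ (vdescs-lift vc₁ ds₁) (vdescs-lift vc₂ ds₂) ,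
      s≤s (subst (_ ≤_) (sym (length-++ ws₁)) (+-mono-≤ n₁≤ n₂≤))
      where
      disjoint : Disjoint ws₁ ws₂
      disjoint (w∈ws₁ , w∈ws₂) = vchildren-disjoint vc₁ vc₂ c₂<c₁ (proj₂ (All.lookup ds₁ w∈ws₁))
                                                                   (proj₂ (All.lookup ds₂ w∈ws₂))

    needsVChild : ∀ {v r i} → rank S v ≡ r → i < r → r ∸ 2 ≤ i → NeedsVChildOfRank S v i
    needsVChild refl i<r r∸2≤i = i<r , inj₂ r∸2≤i

    vdescendants : ∀ r {v} → alive S v ≡ true → rank S v ≡ r → VDescList S v (minVDescendants r)
    vdescendants zero {v} av _ = v ∷ [] , [] ∷ [] , (av , self) ∷ [] , ≤-refl
    vdescendants (suc zero) av rv =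
      let c , ac , vc , rc = vchild av (needsVChild rv ≤-refl z≤n)
      in vdescList-one-child av vc (vdescendants 0 ac rc)
    vdescendants (suc (suc r)) av rv =
      let c₁ , ac₁ , vc₁ , rc₁ = vchild av (needsVChild rv ≤-refl (n≤1+n r))
          c₂ , ac₂ , vc₂ , rc₂ = vchild av (needsVChild rv (m<n⇒m<1+n (n<1+n r)) ≤-refl)
      in vdescList-two-children av vc₁ vc₂ (subst₂ _<_ (sym rc₂) (sym rc₁) (n<1+n r))
                 (vdescendants (suc r) ac₁ rc₁) (vdescendants r ac₂ rc₂)

lemma4p6 : ∀ {a ℓ₁ ℓ₂ : Level} (O : StrictTotalOrder a ℓ₁ ℓ₂) →
    let open HollowHeap O in
    ∀ (S : State) → Reachable S → ∀ (v : ℕ) → alive S v ≡ true →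
      Σ (List ℕ) (λ ws → Unique ws
        × All (λ w → (alive S w ≡ true) × VDesc S w v) ws
        × (fib (rank S v + 3) ∸ 1 ≤ length ws))
lemma4p6 O S R v av =
  subst (VDescList O S v) (cong (_∸ 1) (suc-minVDescendants (rank S v)))
        (Counting.vdescendants O S vpar⇒rank< vchild (rank S v) av refl)
  where
  open HollowHeap O
  open Invariant (reachable⇒invariant O R)
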